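{- Let $s$ be a binary predicate symbol different from $<$. There exists a sentence $\varphi_s$ of the logic $\mathrm{C}^2(*,1,\{<\})$, whose only binary symbols are $<$ and $s$, such that for every finite structure $\mathcal{M}$ in which $<$ is interpreted as a strict linear order, $\mathcal{M}\models\varphi_s$ if and only if $s^{\mathcal{M}}$ is the induced successor relation of $<^{\mathcal{M}}$, i.e. $s^{\mathcal{M}}=\{(a,b): a<^{\mathcal{M}} b \text{ and there is no } c \text{ with } a<^{\mathcal{M}}c<^{\mathcal{M}}b\}$.
   Context: $\mathrm{C}^2$ is the two-variable fragment of first-order logic (variables $x,y$ only, possibly reused) extended with counting quantifiers $\exists^{<k},\exists^{\le k},\exists^{=k},\exists^{\ge k},\exists^{>k}$ for all natural numbers $k$. The logic $\mathrm{C}^2(u,b,I)$ consists of $\mathrm{C}^2$ sentences over a relational signature (no constants) with $u$ unary and $b$ binary predicate symbols (where $*$ means arbitrarily many), not counting the distinguished binary symbols in $I$; here $I=\{<\}$ and $<$ is always interpreted as a strict linear order (the irreflexive part of a linear order). -}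

module Defs where

open import Data.Nat using (ℕ; zero; suc; _+_; _<_; _≤_; _≡ᵇ_; _<ᵇ_; _≤ᵇ_)
open import Data.Bool using (Bool; true; false; not; _∧_; _∨_; if_then_else_)
open import Data.Fin using (Fin)
import Data.Fin
open import Data.List using (List; map; allFin)
open import Data.Nat.ListAction using (sum)
open import Data.Product using (Σ; _×_; ∃)
open import Data.Sum using (_⊎_)
open import Relation.Nullary using (¬_)
open import Relation.Binary.PropositionalEquality using (_≡_)
open import Function.Bundles using (_⇔_)

data Var : Set where
  x y : Var

data Cmp : Set where
  lt le eq ge gt : Cmp

cmp : Cmp → ℕ → ℕ → Bool
cmp lt m k = m <ᵇ k
cmp le m k = m ≤ᵇ k
cmp eq m k = m ≡ᵇ k
cmp ge m k = k ≤ᵇ m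
cmp gt m k = k <ᵇ m

-- Formulas of C² over the signature with u unary symbols (indexed by Fin u),
-- the distinguished binary symbol < and exactly one further binary symbol s
-- (plus equality).  No constants.
data Formula (u : ℕ) : Set where
  unary   : Fin u → Var → Formula u
  less    : Var → Var → Formula u
  succ    : Var → Var → Formula u
  equal   : Var → Var → Formula u
  ⊤f ⊥f   : Formula u
  neg     : Formula u → Formula u
  and or  : Formula u → Formula u → Formula u
  exists all∀ : Var → Formula u → Formula u
  count   : Cmp → ℕ → Var → Formula u → Formula u   -- ∃^{◃k} v φ

_==ᵛ_ : Var → Var → Bool
x ==ᵛ x = true
y ==ᵛ y = true
_ ==ᵛ _ = false

free : ∀ {u} → Var → Formula u → Bool
free v (unary _ w) = v ==ᵛ w
free v (less a b) = (v ==ᵛ a) ∨ (v ==ᵛ b)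
free v (succ a b) = (v ==ᵛ a) ∨ (v ==ᵛ b)
free v (equal a b) = (v ==ᵛ a) ∨ (v ==ᵛ b)
free v ⊤f = false
free v ⊥f = false
free v (neg φ) = free v φ
free v (and φ ψ) = free v φ ∨ free v ψ
free v (or φ ψ) = free v φ ∨ free v ψ
free v (exists w φ) = not (v ==ᵛ w) ∧ free v φ
free v (all∀ w φ) = not (v ==ᵛ w) ∧ free v φ
free v (count _ _ w φ) = not (v ==ᵛ w) ∧ free v φ

Sentence : ∀ {u} → Formula u → Set
Sentence φ = (free x φ ≡ false) × (free y φ ≡ false)

-- A finite structure with domain Fin n (finite structures up to isomorphism)
-- for the signature: u unary predicates, the binary symbols < and s.
record Structure (u n : ℕ) : Set where
  field
    P   : Fin u → Fin n → Bool
    lessᴹ : Fin n → Fin n → Bool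
    succᴹ : Fin n → Fin n → Bool
open Structure public

IsStrictLinearOrder : ∀ {n} → (Fin n → Fin n → Bool) → Set
IsStrictLinearOrder {n} R =
  (∀ a → ¬ (R a a ≡ true)) ×
  (∀ a b c → R a b ≡ true → R b c ≡ true → R a c ≡ true) ×
  (∀ a b → ¬ (a ≡ b) → (R a b ≡ true) ⊎ (R b a ≡ true))

IsInducedSuccessor : ∀ {n} → (Fin n → Fin n → Bool) → (Fin n → Fin n → Bool) → Set
IsInducedSuccessor {n} R S =
  ∀ a b → (S a b ≡ true) ⇔
          ((R a b ≡ true) × ¬ (∃ λ c → (R a c ≡ true) × (R c b ≡ true)))

Assignment : ℕ → Set
Assignment n = Var → Fin n

update : ∀ {n} → Assignment n → Var → Fin n → Assignment n
update ρ v a w = if v ==ᵛ w then a else ρ w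

_≟ᶠ_ : ∀ {n} → Fin n → Fin n → Bool
a ≟ᶠ b = Data.Fin.toℕ a ≡ᵇ Data.Fin.toℕ b

#[_] : ∀ {n} → (Fin n → Bool) → ℕ
#[_] {n} f = sum (map (λ a → if f a then 1 else 0) (allFin n))

anyᶠ allᶠ : ∀ {n} → (Fin n → Bool) → Bool
anyᶠ f = 1 ≤ᵇ #[ f ]
allᶠ f = not (anyᶠ (λ a → not (f a)))

eval : ∀ {u n} → Structure u n → Formula u → Assignment n → Bool
eval M (unary i v) ρ = P M i (ρ v)
eval M (less v w) ρ = lessᴹ M (ρ v) (ρ w)
eval M (succ v w) ρ = succᴹ M (ρ v) (ρ w)
eval M (equal v w) ρ = ρ v ≟ᶠ ρ w
eval M ⊤f ρ = true
eval M ⊥f ρ = false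
eval M (neg φ) ρ = not (eval M φ ρ)
eval M (and φ ψ) ρ = eval M φ ρ ∧ eval M ψ ρ
eval M (or φ ψ) ρ = eval M φ ρ ∨ eval M ψ ρ
eval M (exists v φ) ρ = anyᶠ (λ a → eval M φ (update ρ v a))
eval M (all∀ v φ) ρ = allᶠ (λ a → eval M φ (update ρ v a))
eval M (count c k v φ) ρ = cmp c #[ (λ a → eval M φ (update ρ v a)) ] k

-- M ⊨ φ for a sentence φ over a nonempty domain Fin (suc n):
-- evaluate under the (irrelevant) assignment sending both variables to an element.
_⊨_ : ∀ {u n} → Structure u (suc n) → Formula u → Set
M ⊨ φ = eval M φ (λ _ → Data.Fin.zero) ≡ true

-- The sentence says: s ⊆ <, every element has at most one s-predecessor, and every
-- element that is not <-maximal has an s-successor.  Conversely, show by downward induction along < that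
-- every s-edge a → b is a covering pair a ⋖ b: if some c lay strictly between a and
-- b, let d ⋖ b be the immediate predecessor of b; then a < d, so d has an s-successor,
-- which by induction is its cover b.  Thus a and d are two s-predecessors of b,
-- contradicting a < d.
module Submission where

open import Defs
open import Data.Bool using (Bool; true; false; not; _∧_; _∨_; if_then_else_)
import Data.Bool.Properties as Bool
open import Data.Empty using (⊥-elim)
open import Data.Fin using (Fin)
import Data.Fin as Fin
open import Data.Fin.Induction using (spo-wellFounded; spo-noetherian)
open import Data.Fin.Properties using (any?; 0≢1+n; suc-injective) renaming (_≟_ to _≟ᶠⁱⁿ_)
open import Data.List using (tabulate)
open import Data.List.Properties using (map-tabulate)
open import Data.Nat using (ℕ; zero; suc; _+_; _≤_; z≤n; s≤s; s≤s⁻¹)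
open import Data.Nat.ListAction using (sum)
open import Data.Nat.Properties using (≤ᵇ⇒≤; ≤⇒≤ᵇ; ≤-trans; m≤n+m; n≤0⇒n≡0; ≮⇒≥)
open import Data.Product using (Σ; _×_; _,_; proj₁; proj₂; ∃)
open import Data.Sum using (_⊎_; inj₁; inj₂)
open import Function using (_∘_; id; flip)
open import Function.Bundles using (_⇔_; mk⇔; Equivalence)
open import Function.Construct.Composition using (_⇔-∘_)
open import Induction.WellFounded using (Acc; acc)
open import Relation.Binary.Structures using (IsStrictPartialOrder)
open import Relation.Binary.PropositionalEquality
  using (_≡_; refl; sym; trans; cong; subst; resp₂; isEquivalence)
open import Relation.Nullary using (¬_; Dec; yes; no; contradiction)
open import Relation.Nullary.Decidable using (_×-dec_)

open Equivalence using (to; from)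

∧≡true⇔ : ∀ {a b} → a ∧ b ≡ true ⇔ (a ≡ true × b ≡ true)
∧≡true⇔ {true}  = mk⇔ (refl ,_) proj₂
∧≡true⇔ {false} = mk⇔ (λ ()) (λ ())

not≡true⇔ : ∀ {a} → not a ≡ true ⇔ (¬ a ≡ true)
not≡true⇔ {true}  = mk⇔ (λ ()) (contradiction refl)
not≡true⇔ {false} = mk⇔ (λ _ ()) (λ _ → refl)

implies≡true⇔ : ∀ {a b} → not a ∨ b ≡ true ⇔ (a ≡ true → b ≡ true)
implies≡true⇔ {true}  = mk⇔ (λ b _ → b) (λ a→b → a→b refl)
implies≡true⇔ {false} = mk⇔ (λ _ ()) (λ _ → refl)

#[]-suc : ∀ {n} (f : Fin (suc n) → Bool) →
          #[ f ] ≡ (if f Fin.zero then 1 else 0) + #[ f ∘ Fin.suc ]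
#[]-suc {n} f = cong ((indicator Fin.zero +_) ∘ sum)
  (trans (map-tabulate Fin.suc indicator) (sym (map-tabulate id (indicator ∘ Fin.suc))))
  where
  indicator : Fin (suc n) → ℕ
  indicator a = if f a then 1 else 0

#≥1⇒∃ : ∀ {n} (f : Fin n → Bool) → 1 ≤ #[ f ] → ∃ λ a → f a ≡ true
#≥1⇒∃ {zero}  f ()
#≥1⇒∃ {suc n} f pos with f Fin.zero in f0 | subst (1 ≤_) (#[]-suc f) pos
... | true  | _    = Fin.zero , f0
... | false | pos′ = let a , fa = #≥1⇒∃ (f ∘ Fin.suc) pos′ in Fin.suc a , fa

∃⇒#≥1 : ∀ {n} (f : Fin n → Bool) {a} → f a ≡ true → 1 ≤ #[ f ]
∃⇒#≥1 {suc n} f {Fin.zero}  fa rewrite #[]-suc f | fa = s≤s z≤n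
∃⇒#≥1 {suc n} f {Fin.suc a} fa rewrite #[]-suc f =
  ≤-trans (∃⇒#≥1 (f ∘ Fin.suc) fa) (m≤n+m _ _)

∄⇒#≡0 : ∀ {n} (f : Fin n → Bool) → (∀ a → ¬ f a ≡ true) → #[ f ] ≡ 0
∄⇒#≡0 f none = n≤0⇒n≡0 (≮⇒≥ λ pos → let a , fa = #≥1⇒∃ f pos in none a fa)

#≤1⇒unique : ∀ {n} (f : Fin n → Bool) → #[ f ] ≤ 1 →
             ∀ {a b} → f a ≡ true → f b ≡ true → a ≡ b
#≤1⇒unique {suc n} f ≤1 {Fin.zero}  {Fin.zero}  fa fb = refl
#≤1⇒unique {suc n} f ≤1 {Fin.zero}  {Fin.suc b} fa fb rewrite #[]-suc f | fa =
  contradiction (≤-trans (∃⇒#≥1 (f ∘ Fin.suc) fb) (s≤s⁻¹ ≤1)) λ ()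
#≤1⇒unique {suc n} f ≤1 {Fin.suc a} {Fin.zero}  fa fb rewrite #[]-suc f | fb =
  contradiction (≤-trans (∃⇒#≥1 (f ∘ Fin.suc) fa) (s≤s⁻¹ ≤1)) λ ()
#≤1⇒unique {suc n} f ≤1 {Fin.suc a} {Fin.suc b} fa fb rewrite #[]-suc f =
  cong Fin.suc (#≤1⇒unique (f ∘ Fin.suc) (≤-trans (m≤n+m _ _) ≤1) fa fb)

unique⇒#≤1 : ∀ {n} (f : Fin n → Bool) →
             (∀ {a b} → f a ≡ true → f b ≡ true → a ≡ b) → #[ f ] ≤ 1
unique⇒#≤1 {zero}  f unique = z≤n
unique⇒#≤1 {suc n} f unique rewrite #[]-suc f with f Fin.zero in f0
... | true rewrite ∄⇒#≡0 (f ∘ Fin.suc) (λ a fa → 0≢1+n (unique f0 fa)) = s≤s z≤n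
... | false = unique⇒#≤1 (f ∘ Fin.suc) (λ fa fb → suc-injective (unique fa fb))

module _ {n : ℕ} {f : Fin n → Bool} where

  anyᶠ≡true⇔ : anyᶠ f ≡ true ⇔ ∃ λ a → f a ≡ true
  anyᶠ≡true⇔ = mk⇔ (#≥1⇒∃ f ∘ ≤ᵇ⇒≤ 1 _ ∘ from Bool.T-≡)
                   (λ (_ , fa) → to Bool.T-≡ (≤⇒≤ᵇ (∃⇒#≥1 f fa)))

  atMostOne⇔ : cmp le #[ f ] 1 ≡ true ⇔ (∀ {a b} → f a ≡ true → f b ≡ true → a ≡ b)
  atMostOne⇔ = mk⇔ (#≤1⇒unique f ∘ ≤ᵇ⇒≤ _ 1 ∘ from Bool.T-≡)
                   (to Bool.T-≡ ∘ ≤⇒≤ᵇ ∘ unique⇒#≤1 f)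

allᶠ≡true⇔ : ∀ {n} {f : Fin n → Bool} → allᶠ f ≡ true ⇔ (∀ a → f a ≡ true)
allᶠ≡true⇔ {f = f} = mk⇔ every (from not≡true⇔ ∘ noCounterexample)
  where
  every : allᶠ f ≡ true → ∀ a → f a ≡ true
  every all a with f a in fa
  ... | true  = refl
  ... | false = ⊥-elim (to not≡true⇔ all (from anyᶠ≡true⇔ (a , cong not fa)))

  noCounterexample : (∀ a → f a ≡ true) → ¬ anyᶠ (not ∘ f) ≡ true
  noCounterexample all counterexample =
    let a , not-fa = to anyᶠ≡true⇔ counterexample in to not≡true⇔ not-fa (all a)

record SuccessorAxioms {n : ℕ} (R S : Fin n → Fin n → Bool) : Set where
  field
    S⊆R               : ∀ {a b} → S a b ≡ true → R a b ≡ true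
    predecessor-unique : ∀ {a a′ b} → S a b ≡ true → S a′ b ≡ true → a ≡ a′
    successor-exists   : ∀ {a b} → R a b ≡ true → ∃ λ c → S a c ≡ true

succ⊆less atMostOnePredecessor nonMaximalHasSuccessor successorSentence : ∀ {u} → Formula u
succ⊆less              = all∀ x (all∀ y (or (neg (succ x y)) (less x y)))
atMostOnePredecessor   = all∀ y (count le 1 x (succ x y))
nonMaximalHasSuccessor = all∀ x (or (neg (exists y (less x y))) (exists y (succ x y)))
successorSentence      = and succ⊆less (and atMostOnePredecessor nonMaximalHasSuccessor)

module _ {u n : ℕ} (M : Structure u n) (ρ : Assignment n) where

  ⊨succ⊆less⇔ : eval M succ⊆less ρ ≡ true ⇔
                (∀ {a b} → succᴹ M a b ≡ true → lessᴹ M a b ≡ true)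
  ⊨succ⊆less⇔ = mk⇔
    (λ ⊨φ {a} {b} → to implies≡true⇔ (to allᶠ≡true⇔ (to allᶠ≡true⇔ ⊨φ a) b))
    (λ S⊆R → from allᶠ≡true⇔ λ a → from allᶠ≡true⇔ λ b →
      from (implies≡true⇔ {succᴹ M a b}) S⊆R)

  ⊨atMostOnePredecessor⇔ : eval M atMostOnePredecessor ρ ≡ true ⇔
                           (∀ {a a′ b} → succᴹ M a b ≡ true → succᴹ M a′ b ≡ true → a ≡ a′)
  ⊨atMostOnePredecessor⇔ = mk⇔
    (λ ⊨φ {_} {_} {b} → to atMostOne⇔ (to allᶠ≡true⇔ ⊨φ b))
    (λ unique → from allᶠ≡true⇔ λ b →
      from (atMostOne⇔ {f = λ a → succᴹ M a b}) λ Sab Sa′b → unique Sab Sa′b)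

  ⊨nonMaximalHasSuccessor⇔ : eval M nonMaximalHasSuccessor ρ ≡ true ⇔
                             (∀ {a b} → lessᴹ M a b ≡ true → ∃ λ c → succᴹ M a c ≡ true)
  ⊨nonMaximalHasSuccessor⇔ = mk⇔
    (λ ⊨φ {a} {b} a<b →
      to anyᶠ≡true⇔ (to implies≡true⇔ (to allᶠ≡true⇔ ⊨φ a) (from anyᶠ≡true⇔ (b , a<b))))
    (λ successor → from allᶠ≡true⇔ λ a → from implies≡true⇔ λ ⊨∃ →
      from anyᶠ≡true⇔ (successor (proj₂ (to (anyᶠ≡true⇔ {f = lessᴹ M a}) ⊨∃))))

⊨successorSentence⇔ : ∀ {u n} (M : Structure u (suc n)) →
                      M ⊨ successorSentence ⇔ SuccessorAxioms (lessᴹ M) (succᴹ M)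
⊨successorSentence⇔ {n = n} M = mk⇔
  (λ ⊨φ → let ⊨S⊆R , ⊨unique , ⊨successor = conjuncts ⊨φ in record
    { S⊆R                = to (⊨succ⊆less⇔ M ρ₀) ⊨S⊆R
    ; predecessor-unique = to (⊨atMostOnePredecessor⇔ M ρ₀) ⊨unique
    ; successor-exists   = to (⊨nonMaximalHasSuccessor⇔ M ρ₀) ⊨successor
    })
  (λ ax → from ∧≡true⇔ ( from (⊨succ⊆less⇔ M ρ₀) (S⊆R ax)
                       , from ∧≡true⇔ ( from (⊨atMostOnePredecessor⇔ M ρ₀) (predecessor-unique ax)
                                      , from (⊨nonMaximalHasSuccessor⇔ M ρ₀) (successor-exists ax))))
  where
  open SuccessorAxioms
  ρ₀ : Assignment (suc n)
  ρ₀ _ = Fin.zero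
  conjuncts : M ⊨ successorSentence → eval M succ⊆less ρ₀ ≡ true ×
              eval M atMostOnePredecessor ρ₀ ≡ true × eval M nonMaximalHasSuccessor ρ₀ ≡ true
  conjuncts ⊨φ = let ⊨S⊆R , ⊨rest = to ∧≡true⇔ ⊨φ in ⊨S⊆R , to ∧≡true⇔ ⊨rest

module StrictLinearOrder {n : ℕ} {R : Fin n → Fin n → Bool} (slo : IsStrictLinearOrder R) where

  infix 4 _≺_ _⋖_

  _≺_ : Fin n → Fin n → Set
  a ≺ b = R a b ≡ true

  _⋖_ : Fin n → Fin n → Set
  a ⋖ b = a ≺ b × ¬ ∃ λ c → a ≺ c × c ≺ b

  ≺-irrefl : ∀ a → ¬ a ≺ a
  ≺-irrefl = proj₁ slo

  ≺-trans : ∀ {a b c} → a ≺ b → b ≺ c → a ≺ c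
  ≺-trans = proj₁ (proj₂ slo) _ _ _

  trichotomy : ∀ a b → a ≡ b ⊎ a ≺ b ⊎ b ≺ a
  trichotomy a b with a ≟ᶠⁱⁿ b
  ... | yes a≡b = inj₁ a≡b
  ... | no  a≢b = inj₂ (proj₂ (proj₂ slo) a b a≢b)

  isStrictPartialOrder : IsStrictPartialOrder _≡_ _≺_
  isStrictPartialOrder = record
    { isEquivalence = isEquivalence
    ; irrefl        = λ { refl → ≺-irrefl _ }
    ; trans         = ≺-trans
    ; <-resp-≈      = resp₂ _≺_
    }

  between? : ∀ a b → Dec (∃ λ c → a ≺ c × c ≺ b)
  between? a b = any? λ c → (R a c Bool.≟ true) ×-dec (R c b Bool.≟ true)

  cover-above : ∀ {a b} → a ≺ b → ∃ λ c → a ⋖ c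
  cover-above {a} = go (spo-wellFounded isStrictPartialOrder _)
    where
    go : ∀ {b} → Acc _≺_ b → a ≺ b → ∃ λ c → a ⋖ c
    go {b} (acc smaller) a≺b with between? a b
    ... | yes (c , a≺c , c≺b) = go (smaller c≺b) a≺c
    ... | no  nothing-between = b , a≺b , nothing-between

  cover-below : ∀ {a b} → a ≺ b → ∃ λ c → c ⋖ b
  cover-below {b = b} = go (spo-noetherian isStrictPartialOrder _)
    where
    go : ∀ {a} → Acc (flip _≺_) a → a ≺ b → ∃ λ c → c ⋖ b
    go {a} (acc larger) a≺b with between? a b
    ... | yes (c , a≺c , c≺b) = go (larger a≺c) c≺b
    ... | no  nothing-between = a , a≺b , nothing-between

  ⋖-functional : ∀ {a b b′} → a ⋖ b → a ⋖ b′ → b ≡ b′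
  ⋖-functional {a} {b} {b′} (a≺b , no-mid) (a≺b′ , no-mid′) with trichotomy b b′
  ... | inj₁ b≡b′        = b≡b′
  ... | inj₂ (inj₁ b≺b′) = ⊥-elim (no-mid′ (b , a≺b , b≺b′))
  ... | inj₂ (inj₂ b′≺b) = ⊥-elim (no-mid (b′ , a≺b′ , b′≺b))

  ⋖-injective : ∀ {a a′ b} → a ⋖ b → a′ ⋖ b → a ≡ a′
  ⋖-injective {a} {a′} (a≺b , no-mid) (a′≺b , no-mid′) with trichotomy a a′
  ... | inj₁ a≡a′        = a≡a′
  ... | inj₂ (inj₁ a≺a′) = ⊥-elim (no-mid (a′ , a≺a′ , a′≺b))
  ... | inj₂ (inj₂ a′≺a) = ⊥-elim (no-mid′ (a , a′≺a , a≺b))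

  ≺-below-predecessor : ∀ {a c d b} → a ≺ c → c ≺ b → d ⋖ b → a ≺ d
  ≺-below-predecessor {a} {c} {d} a≺c c≺b (_ , no-mid) with trichotomy c d
  ... | inj₁ refl       = a≺c
  ... | inj₂ (inj₁ c≺d) = ≺-trans a≺c c≺d
  ... | inj₂ (inj₂ d≺c) = ⊥-elim (no-mid (c , d≺c , c≺b))

module _ {n : ℕ} {R S : Fin n → Fin n → Bool} (slo : IsStrictLinearOrder R) where
  open StrictLinearOrder slo

  successorAxioms⇒⋖ : SuccessorAxioms R S → ∀ {a b} → S a b ≡ true → a ⋖ b
  successorAxioms⇒⋖ ax = go (spo-noetherian isStrictPartialOrder _)
    where
    open SuccessorAxioms ax
    go : ∀ {a b} → Acc (flip _≺_) a → S a b ≡ true → a ⋖ b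
    go {a} {b} (acc larger) Sab = S⊆R Sab , λ (c , a≺c , c≺b) →
      let d , d⋖b = cover-below c≺b
          a≺d     = ≺-below-predecessor a≺c c≺b d⋖b
          e , Sde = successor-exists (proj₁ d⋖b)
          Sdb     = subst (λ e → S d e ≡ true) (⋖-functional (go (larger a≺d) Sde) d⋖b) Sde
      in ≺-irrefl a (subst (a ≺_) (predecessor-unique Sdb Sab) a≺d)

  successorAxioms⇔isInducedSuccessor : SuccessorAxioms R S ⇔ IsInducedSuccessor R S
  successorAxioms⇔isInducedSuccessor = mk⇔ induced axioms
    where
    induced : SuccessorAxioms R S → IsInducedSuccessor R S
    induced ax a b = mk⇔ (successorAxioms⇒⋖ ax) λ a⋖b →
      let c , Sac = SuccessorAxioms.successor-exists ax (proj₁ a⋖b)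
      in subst (λ c → S a c ≡ true) (⋖-functional (successorAxioms⇒⋖ ax Sac) a⋖b) Sac

    axioms : IsInducedSuccessor R S → SuccessorAxioms R S
    axioms iso = record
      { S⊆R                = proj₁ ∘ to (iso _ _)
      ; predecessor-unique = λ Sab Sa′b → ⋖-injective (to (iso _ _) Sab) (to (iso _ _) Sa′b)
      ; successor-exists   = λ a≺b → let c , a⋖c = cover-above a≺b in c , from (iso _ c) a⋖c
      }

lemma3p1 : Σ ℕ λ u → Σ (Formula u) λ φ → Sentence φ ×
             (∀ n (M : Structure u (suc n)) → IsStrictLinearOrder (lessᴹ M) →
                (M ⊨ φ) ⇔ IsInducedSuccessor (lessᴹ M) (succᴹ M))
lemma3p1 = 0 , successorSentence , (refl , refl) , λ n M slo →
  successorAxioms⇔isInducedSuccessor slo ⇔-∘ ⊨successorSentence⇔ M
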